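{- Let $H$ be an acyclic graph, and let $\chi$ be a uniformly random 2-coloring of $V(H)$. Then the random graphs \[ H_1=(V(H),\{uv\in E(H):\chi(u)=\chi(v)\}),\qquad H_2=(V(H),\{uv\in E(H):\chi(u)\ne\chi(v)\}) \] are identically distributed. -}

module Defs where

open import Data.Nat using (ℕ; zero; suc; _+_)
open import Data.Bool using (Bool; true; false; _∧_; _≟_)
open import Data.Bool.Base using (if_then_else_)
open import Data.Fin using (Fin; zero; suc; inject₁; fromℕ)
open import Data.Fin.Properties using (all?)
open import Data.List using (List; []; _∷_; _++_; map; filter; length)
open import Data.Product using (Σ; _,_)
open import Function.Definitions using (Injective)
open import Relation.Binary.PropositionalEquality using (_≡_)
open import Relation.Nullary using (¬_; Dec)

record Graph (n : ℕ) : Set where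
  field
    adj   : Fin n → Fin n → Bool
    sym   : ∀ u v → adj u v ≡ adj v u
    irrefl : ∀ v → adj v v ≡ false
open Graph public

record Cycle {n : ℕ} (G : Graph n) : Set where
  field
    k        : ℕ
    vtx      : Fin (3 + k) → Fin n
    distinct : Injective _≡_ _≡_ vtx
    step     : ∀ (i : Fin (2 + k)) → adj G (vtx (inject₁ i)) (vtx (suc i)) ≡ true
    close    : adj G (vtx (fromℕ (2 + k))) (vtx zero) ≡ true

Acyclic : {n : ℕ} → Graph n → Set
Acyclic G = ¬ Cycle G

Coloring : ℕ → Set
Coloring n = Fin n → Bool

allColorings : (n : ℕ) → List (Coloring n)
allColorings zero = (λ ()) ∷ []
allColorings (suc n) =
  map (λ χ → λ { zero → false ; (suc i) → χ i }) (allColorings n) ++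
  map (λ χ → λ { zero → true  ; (suc i) → χ i }) (allColorings n)

EdgeSet : ℕ → Set
EdgeSet n = Fin n → Fin n → Bool

_==_ : Bool → Bool → Bool
true  == b = b
false == true = false
false == false = true

monoEdges : {n : ℕ} → Graph n → Coloring n → EdgeSet n
monoEdges G χ u v = adj G u v ∧ (χ u == χ v)

biEdges : {n : ℕ} → Graph n → Coloring n → EdgeSet n
biEdges G χ u v = adj G u v ∧ Data.Bool.not (χ u == χ v)
  where import Data.Bool

_≐_ : {n : ℕ} → EdgeSet n → EdgeSet n → Set
F ≐ F' = ∀ u v → F u v ≡ F' u v

_≐?_ : {n : ℕ} (F F' : EdgeSet n) → Dec (F ≐ F')
F ≐? F' = all? (λ u → all? (λ v → F u v ≟ F' u v))

-- Number of colourings χ (out of 2^n, i.e. 2^n times the probability under a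
-- uniform random colouring) for which the random graph f χ equals F.
countColorings : {n : ℕ} → (Coloring n → EdgeSet n) → EdgeSet n → ℕ
countColorings {n} f F = length (filter (λ χ → f χ ≐? F) (allColorings n))

-- An acyclic graph H has a proper 2-colouring c: a vertex of degree at most one can be
-- deleted and coloured last, and a graph without such a vertex carries a non-backtracking
-- walk whose first repeated vertex closes a cycle. An edge is monochromatic under χ exactly
-- when it is bichromatic under χ ⊕ c, so H₁(χ) = H₂(χ ⊕ c), and χ ↦ χ ⊕ c permutes the
-- 2ⁿ colourings.
module Submission where

open import Defs renaming (sym to adj-sym)
open import Data.Bool using (Bool; true; false; not; _xor_; _∧_)
open import Data.Bool.Properties using (not-involutive) renaming (_≟_ to _≟ᴮ_)
open import Data.Fin using (Fin; zero; suc; toℕ; punchIn; punchOut; inject₁; fromℕ)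
open import Data.Fin.Properties
  using (_≟_; any?; all?; ¬∀⟶∃¬; pigeonhole; punchIn-injective; punchIn-punchOut;
         toℕ-inject₁; toℕ-fromℕ; toℕ≤pred[n])
  renaming (<-cmp to <-cmpᶠ)
open import Data.List using (List; []; _∷_; _++_; map; filter; length)
open import Data.List.Properties using (filter-++; length-++; filter-≐)
open import Data.Nat using (ℕ; zero; suc; _+_; _<_; s≤s)
open import Data.Nat.Properties
  using (+-comm; +-suc; +-identityʳ; +-monoʳ-<; +-monoʳ-≤; n<1+n; anyUpTo?; m≤n⇒∃[o]m+o≡n)
open import Data.Product using (∃; ∃₂; _×_; _,_; proj₁; proj₂)
open import Data.Sum using (_⊎_; inj₁; inj₂)
open import Data.Vec.Functional using (head; tail; insertAt) renaming (_∷_ to _∷ᵛ_)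
open import Data.Vec.Functional.Properties using (insertAt-lookup; insertAt-punchIn)
open import Level using (0ℓ)
open import Function using (_∘_; Injective)
open import Relation.Binary using (_Respects_; tri<; tri≈; tri>)
open import Relation.Binary.PropositionalEquality
  using (_≡_; _≢_; _≗_; refl; sym; trans; cong; cong₂; subst; module ≡-Reasoning)
open import Relation.Nullary using (¬_; Dec; yes; no; contradiction)
open import Relation.Nullary.Decidable using (_→-dec_)
open import Relation.Unary using (Pred; Decidable) renaming (_≐_ to _≐ₚ_)

private variable
  n : ℕ

count : {A : Set} {P : Pred A 0ℓ} → Decidable P → List A → ℕ
count P? = length ∘ filter P?

count-cong : {A : Set} {P Q : Pred A 0ℓ} (P? : Decidable P) (Q? : Decidable Q) →
             P ≐ₚ Q → count P? ≗ count Q?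
count-cong P? Q? P≐Q xs = cong length (filter-≐ P? Q? P≐Q xs)

count-map : {A B : Set} {P : Pred B 0ℓ} (P? : Decidable P) (f : A → B) →
            count P? ∘ map f ≗ count (P? ∘ f)
count-map P? f []       = refl
count-map P? f (x ∷ xs) with P? (f x)
... | yes _ = cong suc (count-map P? f xs)
... | no  _ = count-map P? f xs

_⊕_ : Coloring n → Coloring n → Coloring n
(χ ⊕ c) i = χ i xor c i

∷-cong : ∀ b {χ χ′ : Coloring n} → χ ≗ χ′ → (b ∷ᵛ χ) ≗ (b ∷ᵛ χ′)
∷-cong b χ≗χ′ zero    = refl
∷-cong b χ≗χ′ (suc i) = χ≗χ′ i

-- allColorings extends colourings by pattern lambdas that are only pointwise equal to
-- b ∷ᵛ χ, hence the hypothesis that P respects pointwise equality.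
count-allColorings-suc : {P : Pred (Coloring (suc n)) 0ℓ} (P? : Decidable P) → P Respects _≗_ →
  count P? (allColorings (suc n)) ≡
  count (P? ∘ (false ∷ᵛ_)) (allColorings n) + count (P? ∘ (true ∷ᵛ_)) (allColorings n)
count-allColorings-suc {n} {P} P? resp = begin
  count P? (map _ χs ++ map _ χs)
    ≡⟨ cong length (filter-++ P? (map _ χs) (map _ χs)) ⟩
  length (filter P? (map _ χs) ++ filter P? (map _ χs))
    ≡⟨ length-++ (filter P? (map _ χs)) ⟩
  count P? (map _ χs) + count P? (map _ χs)
    ≡⟨ cong₂ _+_ (count-map P? _ χs) (count-map P? _ χs) ⟩
  count (P? ∘ _) χs + count (P? ∘ _) χs
    ≡⟨ cong₂ _+_ (count-cong _ _ (cons≐ false λ { χ zero → refl ; χ (suc i) → refl }) χs)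
                 (count-cong _ _ (cons≐ true λ { χ zero → refl ; χ (suc i) → refl }) χs) ⟩
  count (P? ∘ (false ∷ᵛ_)) χs + count (P? ∘ (true ∷ᵛ_)) χs ∎
  where
  open ≡-Reasoning
  χs = allColorings n
  cons≐ : ∀ {f : Coloring n → Coloring (suc n)} b → (∀ χ → f χ ≗ b ∷ᵛ χ) → (P ∘ f) ≐ₚ (P ∘ (b ∷ᵛ_))
  cons≐ b f≗ = resp (f≗ _) , resp (sym ∘ f≗ _)

⊕-congˡ : ∀ {χ χ′ c : Coloring n} → χ ≗ χ′ → (χ ⊕ c) ≗ (χ′ ⊕ c)
⊕-congˡ {c = c} χ≗χ′ i = cong (_xor c i) (χ≗χ′ i)

∷-⊕ : ∀ b (χ : Coloring n) (c : Coloring (suc n)) → (b ∷ᵛ χ) ⊕ c ≗ (b xor head c) ∷ᵛ (χ ⊕ tail c)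
∷-⊕ b χ c zero    = refl
∷-⊕ b χ c (suc i) = refl

sumBool-xor : ∀ c (g : Bool → ℕ) → g (false xor c) + g (true xor c) ≡ g false + g true
sumBool-xor false g = refl
sumBool-xor true  g = +-comm (g true) (g false)

count-⊕ : ∀ n {P : Pred (Coloring n) 0ℓ} (P? : Decidable P) → P Respects _≗_ → (c : Coloring n) →
          count P? (allColorings n) ≡ count (P? ∘ (_⊕ c)) (allColorings n)
count-⊕ zero    P? resp c = count-cong P? (P? ∘ (_⊕ c)) (resp (λ ()) , resp (λ ())) (allColorings 0)
count-⊕ (suc n) {P} P? resp c = begin
  count P? (allColorings (suc n))
    ≡⟨ count-allColorings-suc P? resp ⟩
  count (P? ∘ (false ∷ᵛ_)) χs + count (P? ∘ (true ∷ᵛ_)) χs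
    ≡⟨ cong₂ _+_ (count-⊕ n _ (resp ∘ ∷-cong false) (tail c))
                 (count-⊕ n _ (resp ∘ ∷-cong true) (tail c)) ⟩
  g false + g true
    ≡⟨ sumBool-xor (head c) g ⟨
  g (false xor head c) + g (true xor head c)
    ≡⟨ cong₂ _+_ (count-cong _ _ (shift false) χs) (count-cong _ _ (shift true) χs) ⟨
  count (P? ∘ (_⊕ c) ∘ (false ∷ᵛ_)) χs + count (P? ∘ (_⊕ c) ∘ (true ∷ᵛ_)) χs
    ≡⟨ count-allColorings-suc (P? ∘ (_⊕ c)) (resp ∘ ⊕-congˡ) ⟨
  count (P? ∘ (_⊕ c)) (allColorings (suc n)) ∎
  where
  open ≡-Reasoning
  χs = allColorings n
  g : Bool → ℕ
  g b = count (P? ∘ (b ∷ᵛ_) ∘ (_⊕ tail c)) χs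
  shift : ∀ b → (λ χ → P ((b ∷ᵛ χ) ⊕ c)) ≐ₚ (λ χ → P ((b xor head c) ∷ᵛ (χ ⊕ tail c)))
  shift b = resp (∷-⊕ b _ c) , resp (sym ∘ ∷-⊕ b _ c)

induce : ∀ {m} → Graph n → (Fin m → Fin n) → Graph m
induce G f = record
  { adj    = λ u v → adj G (f u) (f v)
  ; sym    = λ u v → adj-sym G (f u) (f v)
  ; irrefl = λ v → irrefl G (f v)
  }

induce-acyclic : ∀ {m} (G : Graph n) {f : Fin m → Fin n} → Injective _≡_ _≡_ f →
                 Acyclic G → Acyclic (induce G f)
induce-acyclic G {f} f-inj acyclic C = acyclic record
  { k        = Cycle.k C
  ; vtx      = f ∘ Cycle.vtx C
  ; distinct = Cycle.distinct C ∘ f-inj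
  ; step     = Cycle.step C
  ; close    = Cycle.close C
  }

_∖_ : Graph (suc n) → Fin (suc n) → Graph n
G ∖ x = induce G (punchIn x)

adj-irrefl : (G : Graph n) {u v : Fin n} → adj G u v ≡ true → u ≢ v
adj-irrefl G e refl with () ← trans (sym e) (irrefl G _)

Proper : Graph n → Coloring n → Set
Proper G c = ∀ {u v} → adj G u v ≡ true → c u ≡ not (c v)

data PunchInView (x : Fin (suc n)) : Fin (suc n) → Set where
  here  : PunchInView x x
  there : ∀ u → PunchInView x (punchIn x u)

punchInView : (x u : Fin (suc n)) → PunchInView x u
punchInView x u with x ≟ u
... | yes refl = here
... | no  x≢u  = subst (PunchInView x) (punchIn-punchOut x≢u) (there (punchOut x≢u))

Leaf : Graph n → Fin n → Fin n → Set
Leaf G x y = ∀ z → adj G x z ≡ true → z ≡ y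

-- x gets the colour opposite to that of its only possible neighbour y; when y = x, x is isolated.
leaf-extend : (G : Graph (suc n)) {x y : Fin (suc n)} → Leaf G x y →
              ∃ (Proper (G ∖ x)) → ∃ (Proper G)
leaf-extend G {x} {y} leaf (c , proper) = col , col-proper
  where
  col : Coloring _
  col = insertAt c x (not (insertAt c x false y))

  col-x : ∀ v → adj G x (punchIn x v) ≡ true → col x ≡ not (col (punchIn x v))
  col-x v e = begin
    col x                                  ≡⟨ insertAt-lookup c x _ ⟩
    not (insertAt c x false y)             ≡⟨ cong (not ∘ insertAt c x false) (leaf _ e) ⟨
    not (insertAt c x false (punchIn x v)) ≡⟨ cong not (insertAt-punchIn c x false v) ⟩
    not (c v)                              ≡⟨ cong not (insertAt-punchIn c x _ v) ⟨
    not (col (punchIn x v))                ∎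
    where open ≡-Reasoning

  col-proper : Proper G col
  col-proper {u} {v} e with punchInView x u | punchInView x v
  ... | here     | here     = contradiction refl (adj-irrefl G e)
  ... | here     | there v′ = col-x v′ e
  ... | there u′ | here     = trans (sym (not-involutive _))
                                    (cong not (sym (col-x u′ (trans (adj-sym G x _) e))))
  ... | there u′ | there v′ = begin
    col (punchIn x u′)       ≡⟨ insertAt-punchIn c x _ u′ ⟩
    c u′                     ≡⟨ proper e ⟩
    not (c v′)               ≡⟨ cong not (insertAt-punchIn c x _ v′) ⟨
    not (col (punchIn x v′)) ∎
    where open ≡-Reasoning

Branching : Graph n → Set
Branching {n} G = (x y : Fin n) → ∃ λ z → adj G x z ≡ true × z ≢ y

module _ (G : Graph n) where
  private
    leadsTo? : ∀ x y z → Dec (adj G x z ≡ true → z ≡ y)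
    leadsTo? x y z = (adj G x z ≟ᴮ true) →-dec (z ≟ y)

  leaf-or-branching : ∃₂ (Leaf G) ⊎ Branching G
  leaf-or-branching with any? (λ x → any? (λ y → all? (leadsTo? x y)))
  ... | yes (x , y , leaf) = inj₁ (x , y , leaf)
  ... | no  noLeaf         = inj₂ branching
    where
    branching : Branching G
    branching x y with ¬∀⟶∃¬ n _ (leadsTo? x y) (λ leaf → noLeaf (x , y , leaf))
    ... | z , ¬leadsTo with adj G x z in xz
    ...   | true  = z , xz , λ z≡y → ¬leadsTo (λ _ → z≡y)
    ...   | false = contradiction (λ ()) ¬leadsTo

leastWitness : {P : Pred ℕ 0ℓ} → Decidable P → ∀ {m} → P m → ∃ λ j → P j × (∀ {k} → k < j → ¬ P k)
leastWitness P? Pm with P? 0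
... | yes P0 = 0 , P0 , λ ()
leastWitness P? {zero}  P0  | no ¬P0 = contradiction P0 ¬P0
leastWitness P? {suc m} Psm | no ¬P0 with j , Psj , below ← leastWitness (P? ∘ suc) Psm =
  suc j , Psj , λ { {zero} _ → ¬P0 ; {suc k} (s≤s k<j) → below k<j }

module NonBacktrackingWalk (G : Graph n) (branching : Branching G) (start : Fin n) where

  walk : ℕ → Fin n
  walk 0             = start
  walk 1             = proj₁ (branching start start)
  walk (suc (suc i)) = proj₁ (branching (walk (suc i)) (walk i))

  walk-adj : ∀ i → adj G (walk i) (walk (suc i)) ≡ true
  walk-adj zero    = proj₁ (proj₂ (branching start start))
  walk-adj (suc i) = proj₁ (proj₂ (branching (walk (suc i)) (walk i)))

  walk-nonBacktracking : ∀ i → walk (2 + i) ≢ walk i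
  walk-nonBacktracking i = proj₂ (proj₂ (branching (walk (suc i)) (walk i)))

  Repeat : ℕ → Set
  Repeat j = ∃ λ i → i < j × walk i ≡ walk j

  repeat? : Decidable Repeat
  repeat? j = anyUpTo? (λ i → walk i ≟ walk j) j

  walk-repeats : ∃ Repeat
  walk-repeats with i , j , i<j , eq ← pigeonhole (n<1+n n) (walk ∘ toℕ) = toℕ j , toℕ i , i<j , eq

  -- Minimality makes the closed segment injective; closing after one or two steps is
  -- ruled out by irreflexivity and by non-backtracking.
  cycleAtFirstRepeat : ∀ a k → walk a ≡ walk (suc (a + k)) →
                       (∀ {j} → j < suc (a + k) → ¬ Repeat j) → Cycle G
  cycleAtFirstRepeat a 0 e _ =
    contradiction (trans e (cong (walk ∘ suc) (+-identityʳ a))) (adj-irrefl G (walk-adj a))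
  cycleAtFirstRepeat a 1 e _ =
    contradiction (sym (trans e (cong (walk ∘ suc) (+-comm a 1)))) (walk-nonBacktracking a)
  cycleAtFirstRepeat a (suc (suc k)) e first = record
    { k = k ; vtx = vtx ; distinct = distinct ; step = step ; close = close }
    where
    vtx : Fin (3 + k) → Fin n
    vtx t = walk (a + toℕ t)

    inSegment : ∀ t → a + toℕ t < suc (a + suc (suc k))
    inSegment t = s≤s (+-monoʳ-≤ a (toℕ≤pred[n] t))

    distinct : Injective _≡_ _≡_ vtx
    distinct {s} {t} eq with <-cmpᶠ s t
    ... | tri< s<t _ _ = contradiction (a + toℕ s , +-monoʳ-< a s<t , eq) (first (inSegment t))
    ... | tri≈ _ s≡t _ = s≡t
    ... | tri> _ _ t<s = contradiction (a + toℕ t , +-monoʳ-< a t<s , sym eq) (first (inSegment s))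

    step : ∀ i → adj G (vtx (inject₁ i)) (vtx (suc i)) ≡ true
    step i rewrite toℕ-inject₁ i | +-suc a (toℕ i) = walk-adj (a + toℕ i)

    close : adj G (vtx (fromℕ (2 + k))) (vtx zero) ≡ true
    close rewrite toℕ-fromℕ (2 + k) | +-identityʳ a =
      subst (λ v → adj G (walk (a + suc (suc k))) v ≡ true) (sym e) (walk-adj (a + suc (suc k)))

  cycle : Cycle G
  cycle with leastWitness repeat? (proj₂ walk-repeats)
  ... | j , (a , a<j , e) , first with m≤n⇒∃[o]m+o≡n a<j
  ...   | k , refl = cycleAtFirstRepeat a k e first

acyclic⇒properColoring : ∀ n (G : Graph n) → Acyclic G → ∃ (Proper G)
acyclic⇒properColoring zero    G _ = (λ ()) , λ { {()} }
acyclic⇒properColoring (suc n) G acyclic with leaf-or-branching G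
... | inj₁ (x , _ , leaf) =
  leaf-extend G leaf (acyclic⇒properColoring n (G ∖ x) (induce-acyclic G (punchIn-injective x _ _) acyclic))
... | inj₂ branching = contradiction (NonBacktrackingWalk.cycle G branching zero) acyclic

==-xor-not : ∀ a b c → (a == b) ≡ not ((a xor not c) == (b xor c))
==-xor-not true  true  true  = refl
==-xor-not true  true  false = refl
==-xor-not true  false true  = refl
==-xor-not true  false false = refl
==-xor-not false true  true  = refl
==-xor-not false true  false = refl
==-xor-not false false true  = refl
==-xor-not false false false = refl

monoEdges≐biEdges-⊕ : (H : Graph n) {c : Coloring n} → Proper H c →
                      ∀ χ → monoEdges H χ ≐ biEdges H (χ ⊕ c)
monoEdges≐biEdges-⊕ H {c} proper χ u v with adj H u v in uv
... | false = refl
... | true rewrite proper uv = ==-xor-not (χ u) (χ v) (c v)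

biEdges-cong : (H : Graph n) {χ χ′ : Coloring n} → χ ≗ χ′ → biEdges H χ ≐ biEdges H χ′
biEdges-cong H χ≗χ′ u v = cong₂ (λ a b → adj H u v ∧ not (a == b)) (χ≗χ′ u) (χ≗χ′ v)

mainTheorem11 : (n : ℕ) (H : Graph n) → Acyclic H →
    (F : EdgeSet n) → countColorings (monoEdges H) F ≡ countColorings (biEdges H) F
mainTheorem11 n H acyclic F with acyclic⇒properColoring n H acyclic
... | c , proper = begin
  countColorings (monoEdges H) F
    ≡⟨ count-cong _ _ ((λ {χ} → mono⇒bi {χ}) , (λ {χ} → bi⇒mono {χ})) (allColorings n) ⟩
  count (λ χ → biEdges H (χ ⊕ c) ≐? F) (allColorings n)
    ≡⟨ count-⊕ n (λ χ → biEdges H χ ≐? F) respects c ⟨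
  countColorings (biEdges H) F ∎
  where
  open ≡-Reasoning
  mono⇒bi : ∀ {χ} → monoEdges H χ ≐ F → biEdges H (χ ⊕ c) ≐ F
  mono⇒bi {χ} m≐F u v = trans (sym (monoEdges≐biEdges-⊕ H proper χ u v)) (m≐F u v)
  bi⇒mono : ∀ {χ} → biEdges H (χ ⊕ c) ≐ F → monoEdges H χ ≐ F
  bi⇒mono {χ} b≐F u v = trans (monoEdges≐biEdges-⊕ H proper χ u v) (b≐F u v)
  respects : (λ χ → biEdges H χ ≐ F) Respects _≗_
  respects χ≗χ′ b≐F u v = trans (sym (biEdges-cong H χ≗χ′ u v)) (b≐F u v)
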